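{- Let $G=(V,E)$ be a connected undirected (multi)graph with edge weights $\mathbf w\colon E\to\mathbb R$, and let $e\in E$. Let $\varphi(G)$ be obtained from $G$ by replacing $e$ with a simple path of $k$ edges $P=\{e_1,\dots,e_k\}$ (with $k-1$ new internal vertices) between the endpoints of $e$, where $\mathbf w(e_i)=w_i$ with all $w_i\neq 0$ and $\frac1{w_1}+\cdots+\frac1{w_k}\neq 0$, and all other edges keep their weights. Define $w'$ by $\frac{1}{w'}=\frac1{w_1}+\cdots+\frac1{w_k}$ and $C_P=\frac{1}{w'}\prod_{i=1}^k w_i$. Then $$Z_R(\varphi(G);\mathbf w)=C_P\cdot Z_R(G;\mathbf w[e\mapsto w']),$$ where $\mathbf w[e\mapsto w']$ denotes the weight function equal to $\mathbf w$ except that $e$ gets weight $w'$.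
   Context: For a connected undirected (multi)graph $G=(V,E)$ with edge weights $\mathbf w\colon E\to\mathbb R$, the weighted reliability polynomial is $Z_R(G;\mathbf w)=\sum_{A\subseteq E,\ \kappa(A)=1}\prod_{f\in A}\mathbf w(f)$, where $\kappa(A)$ is the number of connected components of $(V,A)$. -}

module Defs where

open import Level using (Level)
open import Algebra.Bundles using (CommutativeRing)
open import Data.Nat as ℕ using (ℕ; zero; suc; _<?_)
open import Data.Fin as Fin using (Fin; zero; suc; splitAt; _↑ˡ_; _↑ʳ_; fromℕ<; toℕ)
open import Data.Fin.Properties using (any?; all?)
open import Data.Bool as Bool using (Bool; true; false; if_then_else_)
open import Data.Product using (Σ; _×_; _,_; proj₁; proj₂)
open import Data.Sum using (_⊎_; inj₁; inj₂)
open import Data.List using (List; []; _∷_; map; _++_; foldr)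
open import Relation.Nullary using (Dec; yes; no; does)
open import Relation.Nullary.Decidable using (_×-dec_; _⊎-dec_)
open import Relation.Binary.PropositionalEquality using (_≡_)

-- Vertices are Fin nV, edges are Fin nE; each edge has an (unordered)
-- pair of endpoints, stored as an ordered pair but always used symmetrically.

record Multigraph : Set where
  field
    nV   : ℕ
    nE   : ℕ
    ends : Fin nE → Fin nV × Fin nV

open Multigraph public

EdgeSet : Multigraph → Set
EdgeSet G = Fin (nE G) → Bool

Step : (G : Multigraph) → EdgeSet G → Fin (nV G) → Fin (nV G) → Set
Step G A x y = Σ (Fin (nE G)) λ f → (A f ≡ true) ×
  ((proj₁ (ends G f) ≡ x × proj₂ (ends G f) ≡ y) ⊎
   (proj₂ (ends G f) ≡ x × proj₁ (ends G f) ≡ y))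

Reach : (G : Multigraph) → EdgeSet G → ℕ → Fin (nV G) → Fin (nV G) → Set
Reach G A zero    x y = x ≡ y
Reach G A (suc t) x y = Reach G A t x y ⊎ (Σ (Fin (nV G)) λ z → Step G A x z × Reach G A t z y)

-- κ(A) = 1 : the spanning subgraph (V, A) has exactly one connected component,
-- i.e. V is nonempty and any two vertices are joined by a walk in A
-- (a walk of length ≤ |V| exists iff any walk exists).
Connected : (G : Multigraph) → EdgeSet G → Set
Connected G A = (0 ℕ.< nV G) × (∀ x y → Reach G A (nV G) x y)

ConnectedGraph : Multigraph → Set
ConnectedGraph G = Connected G (λ _ → true)

step? : (G : Multigraph) (A : EdgeSet G) → ∀ x y → Dec (Step G A x y)
step? G A x y = any? λ f → (A f Bool.≟ true) ×-dec
  (((proj₁ (ends G f) Fin.≟ x) ×-dec (proj₂ (ends G f) Fin.≟ y)) ⊎-dec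
   ((proj₂ (ends G f) Fin.≟ x) ×-dec (proj₁ (ends G f) Fin.≟ y)))

reach? : (G : Multigraph) (A : EdgeSet G) → ∀ t x y → Dec (Reach G A t x y)
reach? G A zero    x y = x Fin.≟ y
reach? G A (suc t) x y = reach? G A t x y ⊎-dec any? λ z → step? G A x z ×-dec reach? G A t z y

connected? : (G : Multigraph) (A : EdgeSet G) → Dec (Connected G A)
connected? G A = (0 ℕ.<? nV G) ×-dec all? λ x → all? λ y → reach? G A (nV G) x y

consB : ∀ {m} → Bool → (Fin m → Bool) → Fin (suc m) → Bool
consB b s zero    = b
consB b s (suc i) = s i

subsets : (m : ℕ) → List (Fin m → Bool)
subsets zero    = (λ ()) ∷ []
subsets (suc m) = map (consB false) (subsets m) ++ map (consB true) (subsets m)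

module _ {c ℓ : Level} (R : CommutativeRing c ℓ) where
  open CommutativeRing R using (Carrier; _+_; _*_; 0#; 1#)

  sumFin : ∀ {k} → (Fin k → Carrier) → Carrier
  sumFin {zero}  a = 0#
  sumFin {suc k} a = a zero + sumFin (λ i → a (suc i))

  prodFin : ∀ {k} → (Fin k → Carrier) → Carrier
  prodFin {zero}  a = 1#
  prodFin {suc k} a = a zero * prodFin (λ i → a (suc i))

  prodSub : ∀ {m} → (Fin m → Bool) → (Fin m → Carrier) → Carrier
  prodSub A w = prodFin (λ f → if A f then w f else 1#)

  sumList : List Carrier → Carrier
  sumList = foldr _+_ 0#

  ZR : (G : Multigraph) → (Fin (nE G) → Carrier) → Carrier
  ZR G w = sumList (map (λ A → if does (connected? G A) then prodSub A w else 0#)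
                        (subsets (nE G)))

  update : ∀ {m} → (Fin m → Carrier) → Fin m → Carrier → Fin m → Carrier
  update w e w' f = if does (f Fin.≟ e) then w' else w f

-- Subdivision φ(G): replace edge e (endpoints u, v) by a path of k = suc j
-- edges e₁,…,e_k through j new vertices.  New vertex set Fin (nV + j)
-- (old vertices first, then the j new internal vertices), new edge set
-- Fin (nE + j): old edge slot e now holds e₁, the j new slots hold e₂,…,e_k.

module Subdivide (G : Multigraph) (e : Fin (nE G)) (j : ℕ) where
  u v : Fin (nV G)
  u = proj₁ (ends G e)
  v = proj₂ (ends G e)

  pathV : ℕ → Fin (nV G ℕ.+ j)
  pathV zero = u ↑ˡ j
  pathV (suc s) with s <? j
  ... | yes s<j = nV G ↑ʳ fromℕ< s<j
  ... | no  _   = v ↑ˡ j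

  pathEdge : ℕ → Fin (nV G ℕ.+ j) × Fin (nV G ℕ.+ j)
  pathEdge t = pathV t , pathV (suc t)

  lift : Fin (nV G) × Fin (nV G) → Fin (nV G ℕ.+ j) × Fin (nV G ℕ.+ j)
  lift (x , y) = x ↑ˡ j , y ↑ˡ j

  ends′ : Fin (nE G ℕ.+ j) → Fin (nV G ℕ.+ j) × Fin (nV G ℕ.+ j)
  ends′ g with splitAt (nE G) g
  ... | inj₁ f with f Fin.≟ e
  ...   | yes _ = pathEdge 0
  ...   | no  _ = lift (ends G f)
  ends′ g | inj₂ i = pathEdge (suc (toℕ i))

  graph : Multigraph
  graph = record { nV = nV G ℕ.+ j ; nE = nE G ℕ.+ j ; ends = ends′ }

  -- weights: old edges keep w, path edge e_{t+1} gets ws t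
  weights : ∀ {a} {A : Set a} → (Fin (nE G) → A) → (Fin (suc j) → A) → Fin (nE G ℕ.+ j) → A
  weights w ws g with splitAt (nE G) g
  ... | inj₁ f with f Fin.≟ e
  ...   | yes _ = ws zero
  ...   | no  _ = w f
  weights w ws g | inj₂ i = ws (suc i)

φ : (G : Multigraph) → Fin (nE G) → ℕ → Multigraph
φ = Subdivide.graph

φw : ∀ {a} {A : Set a} (G : Multigraph) (e : Fin (nE G)) (j : ℕ) →
     (Fin (nE G) → A) → (Fin (suc j) → A) → Fin (nE (φ G e j)) → A
φw G e j = Subdivide.weights G e j

module Submission where

-- Sort the edge sets of φ(G) by their trace B on the old edges and by the set P of
-- path edges they contain. If P is the whole path, the edge set is connected iff
-- B ∪ {e} is; if exactly one path edge is missing, iff B ∖ {e} is; if two are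
-- missing, the path vertices between them are cut off. So, summing over P, the
-- weight of B is multiplied by Π wᵢ when B ∪ {e} is connected and by Σᵢ Π_{t≠i} w_t
-- when B ∖ {e} is. Since C_P · w′ = Π wᵢ and C_P = Σᵢ Π_{t≠i} w_t, pairing B ∖ {e}
-- with B ∪ {e} gives C_P times the corresponding terms of Z_R(G; w[e ↦ w′]).

open import Level using (Level)
open import Algebra.Bundles using (CommutativeRing)
open import Data.Nat as ℕ using (ℕ; zero; suc; z≤n; s≤s; _≤_; _<_; _≤?_; _<?_)
import Data.Nat.Properties as ℕ
open import Data.Fin as Fin using (Fin; zero; suc; toℕ; fromℕ<; splitAt; _↑ˡ_; _↑ʳ_)
open import Data.Fin.Properties
  using (pigeonhole; toℕ-injective; toℕ<n; toℕ-fromℕ<; fromℕ<-toℕ;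
         splitAt-↑ˡ; splitAt-↑ʳ; splitAt⁻¹-↑ˡ; splitAt⁻¹-↑ʳ)
open import Data.Vec.Functional using (head; tail; updateAt; _++_)
open import Data.Vec.Functional.Properties using (updateAt-updates; updateAt-minimal)
open import Data.Bool using (Bool; true; false; if_then_else_; _∧_)
open import Data.Bool.Properties using (∧-zeroʳ)
open import Data.Product using (Σ; _×_; _,_; proj₁; proj₂)
open import Data.List as List using (List; []; _∷_)
open import Data.List.Properties using (map-++; map-∘)
open import Data.Sum using (_⊎_; inj₁; inj₂; [_,_]′)
open import Function using (_∘_; const; _⇔_; mk⇔)
open import Relation.Nullary using (yes; no; does; ¬_; contradiction)
open import Relation.Nullary.Decidable using (dec-true; dec-false; does-⇔)
open import Relation.Binary.PropositionalEquality
  using (_≡_; _≢_; refl; sym; trans; cong; cong₂; subst; subst₂)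
open import Relation.Binary.Definitions using (tri<; tri≈; tri>)
open import Relation.Binary.Construct.Closure.ReflexiveTransitive
  using (Star; ε; _◅_; _◅◅_; reverse; kleisliStar; fold)
import Relation.Binary.Construct.Closure.ReflexiveTransitive as Star

open import Defs

Walk : (G : Multigraph) → EdgeSet G → Fin (nV G) → Fin (nV G) → Set
Walk G A = Star (Step G A)

module _ {G : Multigraph} {A : EdgeSet G} where

  step-sym : ∀ {x y} → Step G A x y → Step G A y x
  step-sym (f , a , inj₁ (p , q)) = f , a , inj₂ (q , p)
  step-sym (f , a , inj₂ (p , q)) = f , a , inj₁ (q , p)

  reverseWalk : ∀ {x y} → Walk G A x y → Walk G A y x
  reverseWalk = reverse step-sym

  length : ∀ {x y} → Walk G A x y → ℕ
  length ε       = 0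
  length (_ ◅ p) = suc (length p)

  length-◅◅ : ∀ {x y z} (p : Walk G A x y) (q : Walk G A y z) →
              length (p ◅◅ q) ≡ length p ℕ.+ length q
  length-◅◅ ε       q = refl
  length-◅◅ (s ◅ p) q = cong suc (length-◅◅ p q)

  reach⇒walk : ∀ t {x y} → Reach G A t x y → Walk G A x y
  reach⇒walk zero    refl               = ε
  reach⇒walk (suc t) (inj₁ r)           = reach⇒walk t r
  reach⇒walk (suc t) (inj₂ (_ , s , r)) = s ◅ reach⇒walk t r

  walk⇒reach-length : ∀ {x y} (p : Walk G A x y) → Reach G A (length p) x y
  walk⇒reach-length ε       = refl
  walk⇒reach-length (s ◅ p) = inj₂ (_ , s , walk⇒reach-length p)

  reach-mono : ∀ {t t′} → t ≤ t′ → ∀ {x y} → Reach G A t x y → Reach G A t′ x y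
  reach-mono {zero}  {zero}   _          r                  = r
  reach-mono {zero}  {suc t′} _          r                  = inj₁ (reach-mono {zero} {t′} z≤n r)
  reach-mono {suc t} {suc t′} (s≤s t≤t′) (inj₁ r)           = inj₁ (reach-mono t≤t′ r)
  reach-mono {suc t} {suc t′} (s≤s t≤t′) (inj₂ (z , s , r)) = inj₂ (z , s , reach-mono t≤t′ r)

  vertexAt : ∀ {x y} → Walk G A x y → ℕ → Fin (nV G)
  vertexAt {x} ε       _       = x
  vertexAt {x} (_ ◅ p) zero    = x
  vertexAt     (_ ◅ p) (suc k) = vertexAt p k

  prefix : ∀ {x y} (p : Walk G A x y) k → Σ (Walk G A x (vertexAt p k)) λ q → length q ≤ k
  prefix ε       k       = ε , z≤n
  prefix (s ◅ p) zero    = ε , z≤n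
  prefix (s ◅ p) (suc k) with q , q≤k ← prefix p k = s ◅ q , s≤s q≤k

  suffix : ∀ {x y} (p : Walk G A x y) k → Σ (Walk G A (vertexAt p k) y) λ q → length q ≡ length p ℕ.∸ k
  suffix ε       k       = ε , sym (ℕ.0∸n≡0 k)
  suffix (s ◅ p) zero    = s ◅ p , refl
  suffix (s ◅ p) (suc k) = suffix p k

  shortcut : ∀ {x y} (p : Walk G A x y) {i k} → i < k → k ≤ length p →
             vertexAt p i ≡ vertexAt p k → Σ (Walk G A x y) λ q → length q < length p
  shortcut p {i} {k} i<k k≤len same
    with q₁ , q₁≤i ← prefix p i | q₂ , q₂≡ ← suffix p k | vertexAt p i | same
  ... | _ | refl = q₁ ◅◅ q₂ , shorter
    where
    open ℕ.≤-Reasoning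
    shorter : length (q₁ ◅◅ q₂) < length p
    shorter = begin-strict
      length (q₁ ◅◅ q₂)       ≡⟨ length-◅◅ q₁ q₂ ⟩
      length q₁ ℕ.+ length q₂ ≤⟨ ℕ.+-monoˡ-≤ (length q₂) q₁≤i ⟩
      i ℕ.+ length q₂         ≡⟨ cong (i ℕ.+_) q₂≡ ⟩
      i ℕ.+ (length p ℕ.∸ k)  <⟨ ℕ.+-monoˡ-< (length p ℕ.∸ k) i<k ⟩
      k ℕ.+ (length p ℕ.∸ k)  ≡⟨ ℕ.m+[n∸m]≡n k≤len ⟩
      length p                ∎

  -- a walk longer than nV G repeats a vertex among its first nV G + 1 positions
  shorten : ∀ fuel {x y} (p : Walk G A x y) → length p < fuel →
            Σ (Walk G A x y) λ q → length q ≤ nV G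
  shorten (suc fuel) p len<fuel with length p ≤? nV G
  ... | yes len≤n = p , len≤n
  ... | no  len≰n
    with i , k , i<k , same ← pigeonhole (ℕ.m<n⇒m<1+n (ℕ.≰⇒> len≰n)) (λ i → vertexAt p (toℕ i))
    with q , q<p ← shortcut p i<k (ℕ.≤-pred (toℕ<n k)) same
    = shorten fuel q (ℕ.<-≤-trans q<p (ℕ.≤-pred len<fuel))

  walk⇒reach : ∀ {x y} → Walk G A x y → Reach G A (nV G) x y
  walk⇒reach p with q , q≤n ← shorten (suc (length p)) p ℕ.≤-refl =
    reach-mono q≤n (walk⇒reach-length q)

connected⇒walk : ∀ {G A} → Connected G A → ∀ x y → Walk G A x y
connected⇒walk {G} (_ , reach) x y = reach⇒walk (nV G) (reach x y)

walks⇒connected : ∀ {G A} → 0 < nV G → (∀ x y → Walk G A x y) → Connected G A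
walks⇒connected n>0 walks = n>0 , λ x y → walk⇒reach (walks x y)

module _ {G H : Multigraph} {A : EdgeSet G} {B : EdgeSet H} (ι : Fin (nV G) → Fin (nV H))
         (edgeWalk : ∀ f → A f ≡ true → Walk H B (ι (proj₁ (ends G f))) (ι (proj₂ (ends G f))))
         where

  mapWalk : ∀ {x y} → Walk G A x y → Walk H B (ι x) (ι y)
  mapWalk = kleisliStar ι stepWalk
    where
    stepWalk : ∀ {x y} → Step G A x y → Walk H B (ι x) (ι y)
    stepWalk (f , a , inj₁ (refl , refl)) = edgeWalk f a
    stepWalk (f , a , inj₂ (refl , refl)) = reverseWalk (edgeWalk f a)

walk-invariant : ∀ {G A} {X : Set} (σ : Fin (nV G) → X) →
                 (∀ f → A f ≡ true → σ (proj₁ (ends G f)) ≡ σ (proj₂ (ends G f))) →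
                 ∀ {x y} → Walk G A x y → σ x ≡ σ y
walk-invariant {G} {A} σ edgeInvariant = fold (λ x y → σ x ≡ σ y) stepInvariant refl
  where
  stepInvariant : ∀ {x y z} → Step G A x y → σ y ≡ σ z → σ x ≡ σ z
  stepInvariant (f , a , inj₁ (refl , refl)) = trans (edgeInvariant f a)
  stepInvariant (f , a , inj₂ (refl , refl)) = trans (sym (edgeInvariant f a))

connected-cong : ∀ {G} {A A′ : EdgeSet G} → (∀ f → A f ≡ A′ f) → Connected G A → Connected G A′
connected-cong A≗A′ c@(n>0 , _) = walks⇒connected n>0 λ x y →
  Star.map (λ (f , a , joins) → f , trans (sym (A≗A′ f)) a , joins) (connected⇒walk c x y)

missing : ∀ {k} → (Fin k → Bool) → ℕ
missing {zero}  P = 0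
missing {suc k} P = (if head P then 0 else 1) ℕ.+ missing (tail P)

missing≡0 : ∀ {k} (P : Fin k → Bool) → missing P ≡ 0 → ∀ t → P t ≡ true
missing≡0 {suc k} P none t with P zero in P₀
missing≡0 {suc k} P none zero    | true = P₀
missing≡0 {suc k} P none (suc t) | true = missing≡0 (tail P) none t

missing≥1 : ∀ {k} (P : Fin k → Bool) → 1 ≤ missing P → Σ (Fin k) λ t → P t ≡ false
missing≥1 {suc k} P some with P zero in P₀
... | false = zero , P₀
... | true with t , absent ← missing≥1 (tail P) some = suc t , absent

missing≡1 : ∀ {k} (P : Fin k → Bool) → missing P ≡ 1 →
            Σ (Fin k) λ i → P i ≡ false × (∀ t → t ≢ i → P t ≡ true)
missing≡1 {suc k} P one with P zero in P₀
... | false = zero , P₀ , λ where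
  zero    0≢0 → contradiction refl 0≢0
  (suc t) _   → missing≡0 (tail P) (ℕ.suc-injective one) t
... | true with i , absent , others ← missing≡1 (tail P) one = suc i , absent , λ where
  zero    _   → P₀
  (suc t) t≢i → others t (t≢i ∘ cong suc)

missing≥2 : ∀ {k} (P : Fin k → Bool) → 2 ≤ missing P →
            Σ (Fin k) λ i → Σ (Fin k) λ k → toℕ i < toℕ k × P i ≡ false × P k ≡ false
missing≥2 {suc k} P two with P zero in P₀
... | false with t , absent ← missing≥1 (tail P) (ℕ.s≤s⁻¹ two) = zero , suc t , s≤s z≤n , P₀ , absent
... | true with i , k , i<k , i-absent , k-absent ← missing≥2 (tail P) two =
  suc i , suc k , s≤s i<k , i-absent , k-absent

_[_]≔_ : ∀ {m} → (Fin m → Bool) → Fin m → Bool → Fin m → Bool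
B [ e ]≔ b = updateAt B e (const b)

select : Bool → Bool → ℕ → Bool
select withE withoutE 0             = withE
select withE withoutE 1             = withoutE
select withE withoutE (suc (suc _)) = false

module Subdivision (G : Multigraph) (e : Fin (nE G)) (j : ℕ) where
  open Subdivide G e j using (u; v; pathV; ends′)

  H : Multigraph
  H = φ G e j

  -- An edge set of φ G e j as an edge set B of G plus the set P of path edges present;
  -- slot e of B is overwritten, since it holds the first path edge.
  glue : EdgeSet G → (Fin (suc j) → Bool) → EdgeSet H
  glue B P = (B [ e ]≔ head P) ++ tail P

  pathEdge : Fin (suc j) → Fin (nE H)
  pathEdge zero    = e ↑ˡ j
  pathEdge (suc i) = nE G ↑ʳ i

  ends-pathEdge : ∀ t → ends′ (pathEdge t) ≡ (pathV (toℕ t) , pathV (suc (toℕ t)))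
  ends-pathEdge zero rewrite splitAt-↑ˡ (nE G) e j with e Fin.≟ e
  ... | yes _   = refl
  ... | no  e≢e = contradiction refl e≢e
  ends-pathEdge (suc i) rewrite splitAt-↑ʳ (nE G) j i = refl

  ends-old : ∀ f → f ≢ e → ends′ (f ↑ˡ j) ≡ (proj₁ (ends G f) ↑ˡ j , proj₂ (ends G f) ↑ˡ j)
  ends-old f f≢e rewrite splitAt-↑ˡ (nE G) f j with f Fin.≟ e
  ... | yes f≡e = contradiction f≡e f≢e
  ... | no  _   = refl

  glue-path : ∀ B P t → glue B P (pathEdge t) ≡ P t
  glue-path B P zero    rewrite splitAt-↑ˡ (nE G) e j = updateAt-updates e B
  glue-path B P (suc i) rewrite splitAt-↑ʳ (nE G) j i = refl

  glue-old : ∀ B P f → f ≢ e → glue B P (f ↑ˡ j) ≡ B f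
  glue-old B P f f≢e rewrite splitAt-↑ˡ (nE G) f j = updateAt-minimal f e B f≢e

  edge-cases : ∀ g → (Σ (Fin (nE G)) λ f → f ≢ e × f ↑ˡ j ≡ g) ⊎ (Σ (Fin (suc j)) λ t → pathEdge t ≡ g)
  edge-cases g with splitAt (nE G) g in eq
  ... | inj₂ i = inj₂ (suc i , splitAt⁻¹-↑ʳ eq)
  ... | inj₁ f with f Fin.≟ e
  ...   | yes refl = inj₂ (zero , splitAt⁻¹-↑ˡ eq)
  ...   | no  f≢e  = inj₁ (f , f≢e , splitAt⁻¹-↑ˡ eq)

  vertex-cases : ∀ a → (Σ (Fin (nV G)) λ x → x ↑ˡ j ≡ a) ⊎ (Σ (Fin j) λ s → nV G ↑ʳ s ≡ a)
  vertex-cases a with splitAt (nV G) a in eq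
  ... | inj₁ x = inj₁ (x , splitAt⁻¹-↑ˡ eq)
  ... | inj₂ s = inj₂ (s , splitAt⁻¹-↑ʳ eq)

  pathV-new : ∀ s → pathV (suc (toℕ s)) ≡ nV G ↑ʳ s
  pathV-new s with toℕ s <? j
  ... | yes s<j = cong (nV G ↑ʳ_) (fromℕ<-toℕ s s<j)
  ... | no  s≮j = contradiction (toℕ<n s) s≮j

  pathV-last : pathV (suc j) ≡ v ↑ˡ j
  pathV-last with j <? j
  ... | yes j<j = contradiction j<j (ℕ.<-irrefl refl)
  ... | no  _   = refl

  module _ {X : Set} (τ : Fin (nV H) → X) (c : ℕ → X)
           (τ-u : τ (u ↑ˡ j) ≡ c 0) (τ-v : τ (v ↑ˡ j) ≡ c (suc j))
           (τ-new : ∀ s → τ (nV G ↑ʳ s) ≡ c (suc (toℕ s))) where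

    pathV-along : ∀ t → t ≤ suc j → τ (pathV t) ≡ c t
    pathV-along zero    _       = τ-u
    pathV-along (suc s) s<1+j with s <? j
    ... | yes s<j = trans (τ-new (fromℕ< s<j)) (cong (λ r → c (suc r)) (toℕ-fromℕ< s<j))
    ... | no  s≮j rewrite ℕ.≤-antisym (ℕ.s≤s⁻¹ s<1+j) (ℕ.≮⇒≥ s≮j) = τ-v

  pathStep : ∀ {A : EdgeSet H} t → A (pathEdge t) ≡ true → Step H A (pathV (toℕ t)) (pathV (suc (toℕ t)))
  pathStep t a = pathEdge t , a , inj₁ (cong proj₁ (ends-pathEdge t) , cong proj₂ (ends-pathEdge t))

  segment : ∀ {A : EdgeSet H} a b → a ≤ b → b ≤ suc j →
            (∀ t → a ≤ toℕ t → toℕ t < b → A (pathEdge t) ≡ true) → Walk H A (pathV a) (pathV b)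
  segment     a zero    z≤n _ _ = ε
  segment {A} a (suc b) a≤1+b 1+b≤1+j present with a ≤? b
  ... | yes a≤b =
    segment a b a≤b (ℕ.m≤n⇒m≤1+n (ℕ.s≤s⁻¹ 1+b≤1+j)) (λ t a≤t t<b → present t a≤t (ℕ.m<n⇒m<1+n t<b))
      ◅◅ lastStep ◅ ε
    where
    t = fromℕ< 1+b≤1+j
    t≡b : toℕ t ≡ b
    t≡b = toℕ-fromℕ< 1+b≤1+j
    lastStep : Step H A (pathV b) (pathV (suc b))
    lastStep = subst₂ (Step H A) (cong pathV t≡b) (cong (pathV ∘ suc) t≡b)
      (pathStep t (present t (ℕ.≤-trans a≤b (ℕ.≤-reflexive (sym t≡b))) (ℕ.≤-reflexive (cong suc t≡b))))
  ... | no  a≰b rewrite ℕ.≤-antisym a≤1+b (ℕ.≰⇒> a≰b) = ε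

  n>0 : 0 < nV G
  n>0 = ℕ.≤-<-trans z≤n (toℕ<n u)

  -- Contract every path edge except the i-th: path vertices up to i go to u, the rest to v.
  module Collapse (i : Fin (suc j)) where

    side : ℕ → Fin (nV G)
    side t = if does (t ≤? toℕ i) then u else v

    collapse : Fin (nV H) → Fin (nV G)
    collapse a = [ (λ x → x) , (λ s → side (suc (toℕ s))) ]′ (splitAt (nV G) a)

    collapse-old : ∀ x → collapse (x ↑ˡ j) ≡ x
    collapse-old x rewrite splitAt-↑ˡ (nV G) x j = refl

    collapse-new : ∀ s → collapse (nV G ↑ʳ s) ≡ side (suc (toℕ s))
    collapse-new s rewrite splitAt-↑ʳ (nV G) j s = refl

    collapse-path : ∀ t → t ≤ suc j → collapse (pathV t) ≡ side t
    collapse-path = pathV-along collapse side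
      (trans (collapse-old u) (cong (if_then u else v) (sym (dec-true (0 ≤? toℕ i) z≤n))))
      (trans (collapse-old v) (cong (if_then u else v) (sym (dec-false (suc j ≤? toℕ i) (ℕ.<⇒≱ (toℕ<n i))))))
      collapse-new

    sideWalk : ∀ {B : EdgeSet G} t → (t ≡ toℕ i → B e ≡ true) → Walk G B (side t) (side (suc t))
    sideWalk t e-in with ℕ.<-cmp t (toℕ i)
    ... | tri< t<i _ _
      rewrite dec-true (t ≤? toℕ i) (ℕ.<⇒≤ t<i) | dec-true (suc t ≤? toℕ i) t<i = ε
    ... | tri≈ _ t≡i _
      rewrite dec-true (t ≤? toℕ i) (ℕ.≤-reflexive t≡i)
            | dec-false (suc t ≤? toℕ i) (ℕ.<⇒≱ (ℕ.≤-reflexive (cong suc (sym t≡i))))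
      = (e , e-in t≡i , inj₁ (refl , refl)) ◅ ε
    ... | tri> _ _ t>i
      rewrite dec-false (t ≤? toℕ i) (ℕ.<⇒≱ t>i) | dec-false (suc t ≤? toℕ i) (ℕ.<⇒≱ (ℕ.m<n⇒m<1+n t>i))
      = ε

  collapse-connected : ∀ {A : EdgeSet H} {B : EdgeSet G} (i : Fin (suc j)) →
                       (∀ f → f ≢ e → A (f ↑ˡ j) ≡ true → B f ≡ true) →
                       (A (pathEdge i) ≡ true → B e ≡ true) →
                       Connected H A → Connected G B
  collapse-connected {A} {B} i old-in e-in c = walks⇒connected n>0 λ x y →
    subst₂ (Walk G B) (collapse-old x) (collapse-old y) (mapWalk collapse edgeWalk (connected⇒walk c (x ↑ˡ j) (y ↑ˡ j)))
    where
    open Collapse i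
    edgeWalk : ∀ g → A g ≡ true → Walk G B (collapse (proj₁ (ends′ g))) (collapse (proj₂ (ends′ g)))
    edgeWalk g a with edge-cases g
    ... | inj₁ (f , f≢e , refl)
      rewrite ends-old f f≢e | collapse-old (proj₁ (ends G f)) | collapse-old (proj₂ (ends G f))
      = (f , old-in f f≢e a , inj₁ (refl , refl)) ◅ ε
    ... | inj₂ (t , refl)
      rewrite ends-pathEdge t | collapse-path (toℕ t) (ℕ.<⇒≤ (toℕ<n t)) | collapse-path (suc (toℕ t)) (toℕ<n t)
      = sideWalk (toℕ t) λ t≡i → e-in (subst (λ r → A (pathEdge r) ≡ true) (toℕ-injective t≡i) a)

  expand-connected : ∀ {A : EdgeSet H} {B : EdgeSet G} →
                     (∀ f → f ≢ e → B f ≡ true → A (f ↑ˡ j) ≡ true) →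
                     (B e ≡ true → Walk H A (u ↑ˡ j) (v ↑ˡ j)) →
                     (Walk H A (u ↑ˡ j) (v ↑ˡ j) → ∀ s → Walk H A (u ↑ˡ j) (nV G ↑ʳ s)) →
                     Connected G B → Connected H A
  expand-connected {A} {B} old-in e-in reach-new c =
    walks⇒connected (ℕ.≤-trans n>0 (ℕ.m≤m+n (nV G) j)) λ a b → reverseWalk (fromU a) ◅◅ fromU b
    where
    edgeWalk : ∀ f → B f ≡ true → Walk H A (proj₁ (ends G f) ↑ˡ j) (proj₂ (ends G f) ↑ˡ j)
    edgeWalk f b with f Fin.≟ e
    ... | yes refl = e-in b
    ... | no  f≢e  =
      (f ↑ˡ j , old-in f f≢e b , inj₁ (cong proj₁ (ends-old f f≢e) , cong proj₂ (ends-old f f≢e))) ◅ ε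
    oldWalk : ∀ x y → Walk H A (x ↑ˡ j) (y ↑ˡ j)
    oldWalk x y = mapWalk (_↑ˡ j) edgeWalk (connected⇒walk c x y)
    fromU : ∀ a → Walk H A (u ↑ˡ j) a
    fromU a with vertex-cases a
    ... | inj₁ (x , refl) = oldWalk u x
    ... | inj₂ (s , refl) = reach-new (oldWalk u v) s

  module _ (B : EdgeSet G) (P : Fin (suc j) → Bool) where

    glue-old-≔ : ∀ b f → f ≢ e → glue B P (f ↑ˡ j) ≡ (B [ e ]≔ b) f
    glue-old-≔ b f f≢e = trans (glue-old B P f f≢e) (sym (updateAt-minimal f e B f≢e))

    pathSegment : ∀ a b → a ≤ b → b ≤ suc j → (∀ t → a ≤ toℕ t → toℕ t < b → P t ≡ true) →
                  Walk H (glue B P) (pathV a) (pathV b)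
    pathSegment a b a≤b b≤1+j present =
      segment a b a≤b b≤1+j λ t a≤t t<b → trans (glue-path B P t) (present t a≤t t<b)

    all-present : (∀ t → P t ≡ true) → Connected H (glue B P) ⇔ Connected G (B [ e ]≔ true)
    all-present present = mk⇔
      (collapse-connected (Fin.fromℕ j)
        (λ f f≢e a → trans (sym (glue-old-≔ true f f≢e)) a) (λ _ → updateAt-updates e B))
      (expand-connected (λ f f≢e b → trans (glue-old-≔ true f f≢e) b)
        (λ _ → subst (Walk H _ _) pathV-last (pathSegment 0 (suc j) z≤n ℕ.≤-refl λ t _ _ → present t))
        (λ _ s → subst (Walk H _ _) (pathV-new s)
          (pathSegment 0 (suc (toℕ s)) z≤n (ℕ.m≤n⇒m≤1+n (toℕ<n s)) λ t _ _ → present t)))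

    one-missing : ∀ i → P i ≡ false → (∀ t → t ≢ i → P t ≡ true) →
                  Connected H (glue B P) ⇔ Connected G (B [ e ]≔ false)
    one-missing i absent present = mk⇔
      (collapse-connected i
        (λ f f≢e a → trans (sym (glue-old-≔ false f f≢e)) a)
        (λ a → contradiction (trans (sym a) (trans (glue-path B P i) absent)) λ ()))
      (expand-connected (λ f f≢e b → trans (glue-old-≔ false f f≢e) b)
        (λ b → contradiction (trans (sym b) (updateAt-updates e B)) λ ())
        reach-new)
      where
      reach-new : Walk H (glue B P) (u ↑ˡ j) (v ↑ˡ j) → ∀ s → Walk H (glue B P) (u ↑ˡ j) (nV G ↑ʳ s)
      reach-new uv s with suc (toℕ s) ≤? toℕ i
      ... | yes s<i = subst (Walk H _ _) (pathV-new s)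
            (pathSegment 0 (suc (toℕ s)) z≤n (ℕ.m≤n⇒m≤1+n (toℕ<n s))
              λ t _ t<s+1 → present t λ { refl → ℕ.<-irrefl refl (ℕ.<-≤-trans t<s+1 s<i) })
      ... | no  s≮i = uv ◅◅ reverseWalk (subst₂ (Walk H _) (pathV-new s) pathV-last
            (pathSegment (suc (toℕ s)) (suc j) (s≤s (ℕ.<⇒≤ (toℕ<n s))) ℕ.≤-refl
              λ t s<t _ → present t λ { refl → s≮i s<t }))

    -- Between two missing path edges lies a path vertex that no walk connects to u:
    -- "strictly after edge i and not after edge k" is invariant along present edges.
    two-missing : ∀ i k → toℕ i < toℕ k → P i ≡ false → P k ≡ false → ¬ Connected H (glue B P)
    two-missing i k i<k i-absent k-absent c =
      contradiction (trans (sym (σ-path 0 z≤n)) (trans (walk-invariant σ edgeInvariant walk) σ-k)) λ ()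
      where
      between : ℕ → Bool
      between t = does (toℕ i <? t) ∧ does (t ≤? toℕ k)

      σ : Fin (nV H) → Bool
      σ a = [ const false , (λ s → between (suc (toℕ s))) ]′ (splitAt (nV G) a)

      σ-old : ∀ x → σ (x ↑ˡ j) ≡ false
      σ-old x rewrite splitAt-↑ˡ (nV G) x j = refl

      σ-new : ∀ s → σ (nV G ↑ʳ s) ≡ between (suc (toℕ s))
      σ-new s rewrite splitAt-↑ʳ (nV G) j s = refl

      σ-path : ∀ t → t ≤ suc j → σ (pathV t) ≡ between t
      σ-path = pathV-along σ between
        (trans (σ-old u) (sym (cong (_∧ does (0 ≤? toℕ k)) (dec-false (toℕ i <? 0) λ ()))))
        (trans (σ-old v) (sym (trans (cong (does (toℕ i <? suc j) ∧_)
                                           (dec-false (suc j ≤? toℕ k) (ℕ.<⇒≱ (toℕ<n k))))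
                                     (∧-zeroʳ _))))
        σ-new

      between-step : ∀ t → t ≢ toℕ i → t ≢ toℕ k → between t ≡ between (suc t)
      between-step t t≢i t≢k = cong₂ _∧_
        (does-⇔ (mk⇔ ℕ.m<n⇒m<1+n (λ i<1+t → ℕ.≤∧≢⇒< (ℕ.s≤s⁻¹ i<1+t) (t≢i ∘ sym)))
                (toℕ i <? t) (toℕ i <? suc t))
        (does-⇔ (mk⇔ (λ t≤k → ℕ.≤∧≢⇒< t≤k t≢k) ℕ.<⇒≤) (t ≤? toℕ k) (suc t ≤? toℕ k))

      edgeInvariant : ∀ g → glue B P g ≡ true → σ (proj₁ (ends′ g)) ≡ σ (proj₂ (ends′ g))
      edgeInvariant g a with edge-cases g
      ... | inj₁ (f , f≢e , refl) rewrite ends-old f f≢e = trans (σ-old _) (sym (σ-old _))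
      ... | inj₂ (t , refl) rewrite ends-pathEdge t =
        trans (σ-path (toℕ t) (ℕ.<⇒≤ (toℕ<n t)))
          (trans (between-step (toℕ t) (present-≢ i-absent) (present-≢ k-absent)) (sym (σ-path (suc (toℕ t)) (toℕ<n t))))
        where
        present-≢ : ∀ {r} → P r ≡ false → toℕ t ≢ toℕ r
        present-≢ absent t≡r = contradiction
          (trans (sym a) (trans (glue-path B P t) (trans (cong P (toℕ-injective t≡r)) absent))) λ ()

      walk : Walk H (glue B P) (pathV 0) (pathV (toℕ k))
      walk = connected⇒walk c _ _

      σ-k : σ (pathV (toℕ k)) ≡ true
      σ-k rewrite σ-path (toℕ k) (ℕ.<⇒≤ (toℕ<n k))
                | dec-true (toℕ i <? toℕ k) i<k | dec-true (toℕ k ≤? toℕ k) ℕ.≤-refl = refl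

    connected?-glue : does (connected? H (glue B P)) ≡
      select (does (connected? G (B [ e ]≔ true))) (does (connected? G (B [ e ]≔ false))) (missing P)
    connected?-glue with missing P in count
    ... | 0 = does-⇔ (all-present (missing≡0 P count)) (connected? H _) (connected? G _)
    ... | 1 with i , absent , others ← missing≡1 P count =
      does-⇔ (one-missing i absent others) (connected? H _) (connected? G _)
    ... | suc (suc _)
      with i , k , i<k , i-absent , k-absent ← missing≥2 P (subst (2 ≤_) (sym count) (s≤s (s≤s z≤n)))
      = dec-false (connected? H _) (two-missing i k i<k i-absent k-absent)

module RingSums {c ℓ : Level} (R : CommutativeRing c ℓ) where
  open CommutativeRing R hiding (zero) renaming (refl to ≈-refl; sym to ≈-sym; trans to ≈-trans)
  open import Relation.Binary.Reasoning.Setoid (CommutativeRing.setoid R)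
  open import Algebra.Solver.Ring.NaturalCoefficients.Default commutativeSemiring
  open import Algebra.Properties.CommutativeSemigroup *-commutativeSemigroup using (x∙yz≈y∙xz)

  sumList-++ : ∀ (xs ys : List Carrier) → sumList R (xs List.++ ys) ≈ sumList R xs + sumList R ys
  sumList-++ []       ys = ≈-sym (+-identityˡ _)
  sumList-++ (x ∷ xs) ys = ≈-trans (+-congˡ (sumList-++ xs ys)) (≈-sym (+-assoc _ _ _))

  module _ {A : Set} where

    sumList-map-cong : ∀ {f g : A → Carrier} → (∀ x → f x ≈ g x) → ∀ xs →
                       sumList R (List.map f xs) ≈ sumList R (List.map g xs)
    sumList-map-cong f≈g []       = ≈-refl
    sumList-map-cong f≈g (x ∷ xs) = +-cong (f≈g x) (sumList-map-cong f≈g xs)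

    sumList-map-+ : ∀ (f g : A → Carrier) xs →
                    sumList R (List.map (λ x → f x + g x) xs) ≈ sumList R (List.map f xs) + sumList R (List.map g xs)
    sumList-map-+ f g []       = ≈-sym (+-identityˡ _)
    sumList-map-+ f g (x ∷ xs) = ≈-trans (+-congˡ (sumList-map-+ f g xs)) (interchange _ _ _ _)
      where
      interchange : ∀ a b x y → (a + b) + (x + y) ≈ (a + x) + (b + y)
      interchange = solve 4 (λ a b x y → (a :+ b) :+ (x :+ y) := (a :+ x) :+ (b :+ y)) ≈-refl

    sumList-map-*ˡ : ∀ k (f : A → Carrier) xs →
                     k * sumList R (List.map f xs) ≈ sumList R (List.map (λ x → k * f x) xs)
    sumList-map-*ˡ k f []       = zeroʳ k
    sumList-map-*ˡ k f (x ∷ xs) = ≈-trans (distribˡ k _ _) (+-congˡ (sumList-map-*ˡ k f xs))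

    sumList-map-0# : ∀ (xs : List A) → sumList R (List.map (λ _ → 0#) xs) ≈ 0#
    sumList-map-0# []       = ≈-refl
    sumList-map-0# (x ∷ xs) = ≈-trans (+-identityˡ _) (sumList-map-0# xs)

  ΣSub : (m : ℕ) → ((Fin m → Bool) → Carrier) → Carrier
  ΣSub m F = sumList R (List.map F (subsets m))

  Congruent : ∀ {m} → ((Fin m → Bool) → Carrier) → Set ℓ
  Congruent F = ∀ {A A′} → (∀ i → A i ≡ A′ i) → F A ≈ F A′

  ΣSub-cong : ∀ m {F F′ : (Fin m → Bool) → Carrier} → (∀ A → F A ≈ F′ A) → ΣSub m F ≈ ΣSub m F′
  ΣSub-cong m F≈F′ = sumList-map-cong F≈F′ (subsets m)

  ΣSub-suc : ∀ m (F : (Fin (suc m) → Bool) → Carrier) →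
             ΣSub (suc m) F ≈ ΣSub m (F ∘ consB false) + ΣSub m (F ∘ consB true)
  ΣSub-suc m F = begin
    sumList R (List.map F (Ss false List.++ Ss true))
      ≡⟨ cong (sumList R) (map-++ F (Ss false) (Ss true)) ⟩
    sumList R (List.map F (Ss false) List.++ List.map F (Ss true))
      ≈⟨ sumList-++ (List.map F (Ss false)) (List.map F (Ss true)) ⟩
    sumList R (List.map F (Ss false)) + sumList R (List.map F (Ss true))
      ≡⟨ sym (cong₂ _+_ (cong (sumList R) (map-∘ (subsets m))) (cong (sumList R) (map-∘ (subsets m)))) ⟩
    ΣSub m (F ∘ consB false) + ΣSub m (F ∘ consB true) ∎
    where
    Ss : Bool → List (Fin (suc m) → Bool)
    Ss b = List.map (consB b) (subsets m)

  consB-++ : ∀ {m j} b (B : Fin m → Bool) (C : Fin j → Bool) g → consB b (B ++ C) g ≡ (consB b B ++ C) g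
  consB-++     b B C zero    = refl
  consB-++ {m} b B C (suc g) with splitAt m g
  ... | inj₁ _ = refl
  ... | inj₂ _ = refl

  ++-congʳ : ∀ {m j} {B B′ : Fin m → Bool} (C : Fin j → Bool) → (∀ i → B i ≡ B′ i) →
             ∀ g → (B ++ C) g ≡ (B′ ++ C) g
  ++-congʳ {m} C B≗B′ g with splitAt m g
  ... | inj₁ f = B≗B′ f
  ... | inj₂ _ = refl

  consB-congruent : ∀ {m} {F : (Fin (suc m) → Bool) → Carrier} b → Congruent F → Congruent (F ∘ consB b)
  consB-congruent b F-cong A≗A′ = F-cong λ { zero → refl ; (suc i) → A≗A′ i }

  ΣSub-++ : ∀ m j (F : (Fin (m ℕ.+ j) → Bool) → Carrier) → Congruent F →
            ΣSub (m ℕ.+ j) F ≈ ΣSub m (λ B → ΣSub j (λ C → F (B ++ C)))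
  ΣSub-++ zero    j F F-cong = ≈-sym (+-identityʳ _)
  ΣSub-++ (suc m) j F F-cong = begin
    ΣSub (suc (m ℕ.+ j)) F
      ≈⟨ ΣSub-suc (m ℕ.+ j) F ⟩
    ΣSub (m ℕ.+ j) (F ∘ consB false) + ΣSub (m ℕ.+ j) (F ∘ consB true)
      ≈⟨ +-cong (ΣSub-++ m j _ (consB-congruent false F-cong)) (ΣSub-++ m j _ (consB-congruent true F-cong)) ⟩
    ΣSub m (λ B → ΣSub j (λ C → F (consB false (B ++ C)))) + ΣSub m (λ B → ΣSub j (λ C → F (consB true (B ++ C))))
      ≈⟨ +-cong (ΣSub-cong m λ B → ΣSub-cong j λ C → F-cong (consB-++ false B C))
                (ΣSub-cong m λ B → ΣSub-cong j λ C → F-cong (consB-++ true B C)) ⟩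
    ΣSub m (λ B → ΣSub j (λ C → F (consB false B ++ C))) + ΣSub m (λ B → ΣSub j (λ C → F (consB true B ++ C)))
      ≈⟨ ≈-sym (ΣSub-suc m (λ B → ΣSub j (λ C → F (B ++ C)))) ⟩
    ΣSub (suc m) (λ B → ΣSub j (λ C → F (B ++ C))) ∎

  pairUp : ∀ {m} → Fin m → ((Fin m → Bool) → Carrier) → (Fin m → Bool) → Carrier
  pairUp e F B = if B e then 0# else F (B [ e ]≔ false) + F (B [ e ]≔ true)

  ΣSub-pairUp : ∀ m (e : Fin m) (F : (Fin m → Bool) → Carrier) → Congruent F → ΣSub m F ≈ ΣSub m (pairUp e F)
  ΣSub-pairUp (suc m) zero F F-cong = begin
    ΣSub (suc m) F
      ≈⟨ ΣSub-suc m F ⟩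
    ΣSub m (F ∘ consB false) + ΣSub m (F ∘ consB true)
      ≈⟨ ≈-sym (sumList-map-+ _ _ (subsets m)) ⟩
    ΣSub m (λ B → F (consB false B) + F (consB true B))
      ≈⟨ ΣSub-cong m (λ B → +-cong (F-cong (set-head false B)) (F-cong (set-head true B))) ⟩
    ΣSub m (λ B → pairUp zero F (consB false B))
      ≈⟨ ≈-sym (+-identityʳ _) ⟩
    ΣSub m (λ B → pairUp zero F (consB false B)) + 0#
      ≈⟨ +-congˡ (≈-sym (sumList-map-0# (subsets m))) ⟩
    ΣSub m (λ B → pairUp zero F (consB false B)) + ΣSub m (λ B → pairUp zero F (consB true B))
      ≈⟨ ≈-sym (ΣSub-suc m (pairUp zero F)) ⟩
    ΣSub (suc m) (pairUp zero F) ∎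
    where
    set-head : ∀ b (B : Fin m → Bool) i → consB b B i ≡ (consB false B [ zero ]≔ b) i
    set-head b B zero    = refl
    set-head b B (suc i) = refl
  ΣSub-pairUp (suc m) (suc e) F F-cong = begin
    ΣSub (suc m) F
      ≈⟨ ΣSub-suc m F ⟩
    ΣSub m (F ∘ consB false) + ΣSub m (F ∘ consB true)
      ≈⟨ +-cong (ΣSub-pairUp m e _ (consB-congruent false F-cong)) (ΣSub-pairUp m e _ (consB-congruent true F-cong)) ⟩
    ΣSub m (pairUp e (F ∘ consB false)) + ΣSub m (pairUp e (F ∘ consB true))
      ≈⟨ +-cong (ΣSub-cong m (pairUp-consB false)) (ΣSub-cong m (pairUp-consB true)) ⟩
    ΣSub m (pairUp (suc e) F ∘ consB false) + ΣSub m (pairUp (suc e) F ∘ consB true)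
      ≈⟨ ≈-sym (ΣSub-suc m (pairUp (suc e) F)) ⟩
    ΣSub (suc m) (pairUp (suc e) F) ∎
    where
    set-tail : ∀ b b′ (B : Fin m → Bool) i → consB b (B [ e ]≔ b′) i ≡ (consB b B [ suc e ]≔ b′) i
    set-tail b b′ B zero    = refl
    set-tail b b′ B (suc i) = refl
    pairUp-consB : ∀ b B → pairUp e (F ∘ consB b) B ≈ pairUp (suc e) F (consB b B)
    pairUp-consB b B with B e
    ... | true  = ≈-refl
    ... | false = +-cong (F-cong (set-tail b false B)) (F-cong (set-tail b true B))

  prodFin-cong : ∀ {k} {a b : Fin k → Carrier} → (∀ i → a i ≈ b i) → prodFin R a ≈ prodFin R b
  prodFin-cong {zero}  a≈b = ≈-refl
  prodFin-cong {suc k} a≈b = *-cong (a≈b zero) (prodFin-cong (a≈b ∘ suc))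

  prodFin-++ : ∀ m j (a : Fin (m ℕ.+ j) → Carrier) →
               prodFin R a ≈ prodFin R (λ f → a (f ↑ˡ j)) * prodFin R (λ i → a (m ↑ʳ i))
  prodFin-++ zero    j a = ≈-sym (*-identityˡ _)
  prodFin-++ (suc m) j a = ≈-trans (*-congˡ (prodFin-++ m j (a ∘ suc))) (≈-sym (*-assoc _ _ _))

  prodFin-extract : ∀ {k} (a : Fin k → Carrier) e → prodFin R a ≈ a e * prodFin R (update R a e 1#)
  prodFin-extract {suc k} a zero    = *-congˡ (≈-sym (*-identityˡ _))
  prodFin-extract {suc k} a (suc e) = ≈-trans (*-congˡ (prodFin-extract (a ∘ suc) e)) (x∙yz≈y∙xz _ _ _)

  sumProdExceptOne : ∀ {k} → (Fin k → Carrier) → Carrier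
  sumProdExceptOne {zero}  a = 0#
  sumProdExceptOne {suc k} a = prodFin R (tail a) + head a * sumProdExceptOne (tail a)

  sumFin-inverses : ∀ {k} (a b : Fin k → Carrier) → (∀ i → a i * b i ≈ 1#) →
                    sumFin R b * prodFin R a ≈ sumProdExceptOne a
  sumFin-inverses {zero}  a b ab≈1 = zeroˡ _
  sumFin-inverses {suc k} a b ab≈1 = begin
    (head b + sumFin R (tail b)) * (head a * prodFin R (tail a))
      ≈⟨ expand (head a) (head b) (sumFin R (tail b)) (prodFin R (tail a)) ⟩
    (head a * head b) * prodFin R (tail a) + head a * (sumFin R (tail b) * prodFin R (tail a))
      ≈⟨ +-cong (≈-trans (*-congʳ (ab≈1 zero)) (*-identityˡ _))
                (*-congˡ (sumFin-inverses (tail a) (tail b) (ab≈1 ∘ suc))) ⟩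
    sumProdExceptOne a ∎
    where
    expand : ∀ x y s p → (y + s) * (x * p) ≈ (x * y) * p + x * (s * p)
    expand = solve 4 (λ x y s p → (y :+ s) :* (x :* p) := (x :* y) :* p :+ x :* (s :* p)) ≈-refl

  ΣSub-missing : ∀ k (a : Fin k → Carrier) (g : ℕ → Carrier) → (∀ n → g (suc (suc n)) ≈ 0#) →
                 ΣSub k (λ P → g (missing P) * prodSub R P a) ≈ g 0 * prodFin R a + g 1 * sumProdExceptOne a
  ΣSub-missing zero    a g g≥2≈0 = ≈-trans (+-identityʳ _) (≈-sym (≈-trans (+-congˡ (zeroʳ _)) (+-identityʳ _)))
  ΣSub-missing (suc k) a g g≥2≈0 = begin
    ΣSub (suc k) (λ P → g (missing P) * prodSub R P a)
      ≈⟨ ΣSub-suc k _ ⟩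
    ΣSub k (λ P → g (suc (missing P)) * (1# * prodSub R P a′)) + ΣSub k (λ P → g (missing P) * (head a * prodSub R P a′))
      ≈⟨ +-cong (ΣSub-cong k λ P → *-congˡ (*-identityˡ _)) (ΣSub-cong k λ P → x∙yz≈y∙xz _ _ _) ⟩
    ΣSub k (λ P → g (suc (missing P)) * prodSub R P a′) + ΣSub k (λ P → head a * (g (missing P) * prodSub R P a′))
      ≈⟨ +-cong (ΣSub-missing k a′ (g ∘ suc) (g≥2≈0 ∘ suc)) (≈-sym (sumList-map-*ˡ (head a) _ (subsets k))) ⟩
    (g 1 * prodFin R a′ + g 2 * sumProdExceptOne a′) + head a * ΣSub k (λ P → g (missing P) * prodSub R P a′)
      ≈⟨ +-cong (≈-trans (+-congˡ (≈-trans (*-congʳ (g≥2≈0 0)) (zeroˡ _))) (+-identityʳ _))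
                (*-congˡ (ΣSub-missing k a′ g g≥2≈0)) ⟩
    g 1 * prodFin R a′ + head a * (g 0 * prodFin R a′ + g 1 * sumProdExceptOne a′)
      ≈⟨ regroup (g 0) (g 1) (head a) (prodFin R a′) (sumProdExceptOne a′) ⟩
    g 0 * prodFin R a + g 1 * sumProdExceptOne a ∎
    where
    a′ = tail a
    regroup : ∀ g₀ g₁ x p s → g₁ * p + x * (g₀ * p + g₁ * s) ≈ g₀ * (x * p) + g₁ * (p + x * s)
    regroup = solve 5 (λ g₀ g₁ x p s → g₁ :* p :+ x :* (g₀ :* p :+ g₁ :* s)
                                   := g₀ :* (x :* p) :+ g₁ :* (p :+ x :* s)) ≈-refl

module Reliability {c ℓ : Level} (R : CommutativeRing c ℓ) where
  open CommutativeRing R hiding (zero) renaming (refl to ≈-refl; sym to ≈-sym; trans to ≈-trans)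
  open import Relation.Binary.Reasoning.Setoid (CommutativeRing.setoid R)
  open import Algebra.Solver.Ring.NaturalCoefficients.Default commutativeSemiring
  open import Algebra.Properties.CommutativeSemigroup *-commutativeSemigroup using (x∙yz≈y∙xz)
  open RingSums R

  ZR-term : (G : Multigraph) → (Fin (nE G) → Carrier) → EdgeSet G → Carrier
  ZR-term G w A = if does (connected? G A) then prodSub R A w else 0#

  ZR-term-congruent : ∀ G w → Congruent (ZR-term G w)
  ZR-term-congruent G w {A} {A′} A≗A′ = begin
    ZR-term G w A
      ≡⟨ cong (if_then prodSub R A w else 0#) (does-⇔ (mk⇔ (connected-cong A≗A′) (connected-cong (sym ∘ A≗A′)))
                                                        (connected? G A) (connected? G A′)) ⟩
    (if does (connected? G A′) then prodSub R A w else 0#)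
      ≈⟨ if-cong (does (connected? G A′)) (prodFin-cong λ f → reflexive (cong (if_then w f else 1#) (A≗A′ f))) ⟩
    ZR-term G w A′ ∎
    where
    if-cong : ∀ b {x y} → x ≈ y → (if b then x else 0#) ≈ (if b then y else 0#)
    if-cong true  x≈y = x≈y
    if-cong false _   = ≈-refl

  indicator : Bool → Carrier
  indicator b = if b then 1# else 0#

  if-then-0# : ∀ b {x y} → x ≈ y → (if b then x else 0#) ≈ indicator b * y
  if-then-0# true  x≈y = ≈-trans x≈y (≈-sym (*-identityˡ _))
  if-then-0# false _   = ≈-sym (zeroˡ _)

  module _ (G : Multigraph) (w : Fin (nE G) → Carrier) (e : Fin (nE G)) (j : ℕ) (ws : Fin (suc j) → Carrier) where
    open Subdivision G e j

    weightIn : EdgeSet G → Fin (nE G) → Carrier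
    weightIn B f = if B f then w f else 1#

    restProd : EdgeSet G → Carrier
    restProd B = prodFin R (update R (weightIn B) e 1#)

    restProd-≔ : ∀ B b → restProd (B [ e ]≔ b) ≈ restProd B
    restProd-≔ B b = prodFin-cong factor
      where
      factor : ∀ f → update R (weightIn (B [ e ]≔ b)) e 1# f ≈ update R (weightIn B) e 1# f
      factor f with f Fin.≟ e
      ... | yes _   = ≈-refl
      ... | no  f≢e = reflexive (cong (if_then w f else 1#) (updateAt-minimal f e B f≢e))

    prodSub-update : ∀ X x → prodSub R X (update R w e x) ≈ (if X e then x else 1#) * restProd X
    prodSub-update X x =
      ≈-trans (prodFin-extract _ e) (*-cong (reflexive (cong (if X e then_else 1#) updated)) (prodFin-cong factor))
      where
      updated : update R w e x e ≡ x
      updated = cong (if_then x else w e) (dec-true (e Fin.≟ e) refl)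
      factor : ∀ f → update R (λ f → if X f then update R w e x f else 1#) e 1# f ≈ update R (weightIn X) e 1# f
      factor f with f Fin.≟ e
      ... | yes _ = ≈-refl
      ... | no  _ = ≈-refl

    prodSub-update-≔ : ∀ B b x → prodSub R (B [ e ]≔ b) (update R w e x) ≈ (if b then x else 1#) * restProd B
    prodSub-update-≔ B b x = ≈-trans (prodSub-update (B [ e ]≔ b) x)
      (*-cong (reflexive (cong (if_then x else 1#) (updateAt-updates e B))) (restProd-≔ B b))

    prodSub-glue : ∀ B P → prodSub R (glue B P) (φw G e j w ws) ≈ restProd B * prodSub R P ws
    prodSub-glue B P = begin
      prodSub R (glue B P) (φw G e j w ws)
        ≈⟨ prodFin-++ (nE G) j _ ⟩
      prodFin R (λ f → if glue B P (f ↑ˡ j) then φw G e j w ws (f ↑ˡ j) else 1#) *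
      prodFin R (λ i → if glue B P (nE G ↑ʳ i) then φw G e j w ws (nE G ↑ʳ i) else 1#)
        ≈⟨ *-cong (prodFin-cong old) (prodFin-cong new) ⟩
      prodSub R (B [ e ]≔ head P) (update R w e (head ws)) * prodSub R (tail P) (tail ws)
        ≈⟨ *-congʳ (prodSub-update-≔ B (head P) (head ws)) ⟩
      ((if head P then head ws else 1#) * restProd B) * prodSub R (tail P) (tail ws)
        ≈⟨ ≈-trans (*-assoc _ _ _) (x∙yz≈y∙xz _ _ _) ⟩
      restProd B * prodSub R P ws ∎
      where
      old : ∀ f → (if glue B P (f ↑ˡ j) then φw G e j w ws (f ↑ˡ j) else 1#) ≈
                  (if (B [ e ]≔ head P) f then update R w e (head ws) f else 1#)
      old f rewrite splitAt-↑ˡ (nE G) f j with f Fin.≟ e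
      ... | yes _ = ≈-refl
      ... | no  _ = ≈-refl
      new : ∀ i → (if glue B P (nE G ↑ʳ i) then φw G e j w ws (nE G ↑ʳ i) else 1#) ≈ (if tail P i then tail ws i else 1#)
      new i rewrite splitAt-↑ʳ (nE G) j i = ≈-refl

    ΣSub-glue : ∀ B → ΣSub (suc j) (λ P → ZR-term H (φw G e j w ws) (glue B P)) ≈
                restProd B * (indicator (does (connected? G (B [ e ]≔ true))) * prodFin R ws +
                              indicator (does (connected? G (B [ e ]≔ false))) * sumProdExceptOne ws)
    ΣSub-glue B = begin
      ΣSub (suc j) (λ P → ZR-term H (φw G e j w ws) (glue B P))
        ≈⟨ ΣSub-cong (suc j) summand ⟩
      ΣSub (suc j) (λ P → restProd B * (g (missing P) * prodSub R P ws))
        ≈⟨ ≈-sym (sumList-map-*ˡ (restProd B) _ (subsets (suc j))) ⟩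
      restProd B * ΣSub (suc j) (λ P → g (missing P) * prodSub R P ws)
        ≈⟨ *-congˡ (ΣSub-missing (suc j) ws g λ _ → ≈-refl) ⟩
      restProd B * (g 0 * prodFin R ws + g 1 * sumProdExceptOne ws) ∎
      where
      g : ℕ → Carrier
      g n = indicator (select (does (connected? G (B [ e ]≔ true))) (does (connected? G (B [ e ]≔ false))) n)
      summand : ∀ P → ZR-term H (φw G e j w ws) (glue B P) ≈ restProd B * (g (missing P) * prodSub R P ws)
      summand P rewrite connected?-glue B P =
        ≈-trans (if-then-0# (select _ _ (missing P)) (prodSub-glue B P)) (x∙yz≈y∙xz _ _ _)

    module _ (inv : Fin (suc j) → Carrier) (ws*inv≈1 : ∀ i → ws i * inv i ≈ 1#)
             (w′ : Carrier) (w′*Σinv≈1 : w′ * sumFin R inv ≈ 1#) where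

      scale : Carrier
      scale = sumFin R inv * prodFin R ws

      scale*w′≈prodFin : scale * w′ ≈ prodFin R ws
      scale*w′≈prodFin = ≈-trans (rotate _ _ _) (≈-trans (*-congʳ w′*Σinv≈1) (*-identityˡ _))
        where
        rotate : ∀ s p x → (s * p) * x ≈ (x * s) * p
        rotate = solve 3 (λ s p x → (s :* p) :* x := (x :* s) :* p) ≈-refl

      -- Pairing B ∪ {e} with B matches the two cases "all path edges present" and
      -- "exactly one path edge missing" with the two cases e ∈ A and e ∉ A.
      pairUp-subdivided : ∀ B → pairUp e (λ B′ → ΣSub j (λ C → ZR-term H (φw G e j w ws) (B′ ++ C))) B ≈
                                scale * pairUp e (ZR-term G (update R w e w′)) B
      pairUp-subdivided B with B e
      ... | true  = ≈-sym (zeroʳ _)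
      ... | false = begin
        ΣSub j (λ C → ZR-term H wφ ((B [ e ]≔ false) ++ C)) + ΣSub j (λ C → ZR-term H wφ ((B [ e ]≔ true) ++ C))
          ≈⟨ ≈-sym (ΣSub-suc j (λ P → ZR-term H wφ (glue B P))) ⟩
        ΣSub (suc j) (λ P → ZR-term H wφ (glue B P))
          ≈⟨ ΣSub-glue B ⟩
        restProd B * (iT * prodFin R ws + iF * sumProdExceptOne ws)
          ≈⟨ *-congˡ (+-cong (*-congˡ (≈-sym scale*w′≈prodFin))
                             (*-congˡ (≈-sym (sumFin-inverses ws inv ws*inv≈1)))) ⟩
        restProd B * (iT * (scale * w′) + iF * scale)
          ≈⟨ regroup (restProd B) iT iF scale w′ ⟩
        scale * (iF * (1# * restProd B) + iT * (w′ * restProd B))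
          ≈⟨ *-congˡ (≈-sym (+-cong (if-then-0# without-e (prodSub-update-≔ B false w′))
                                    (if-then-0# with-e (prodSub-update-≔ B true w′)))) ⟩
        scale * (ZR-term G (update R w e w′) (B [ e ]≔ false) + ZR-term G (update R w e w′) (B [ e ]≔ true)) ∎
        where
        wφ = φw G e j w ws
        with-e    = does (connected? G (B [ e ]≔ true))
        without-e = does (connected? G (B [ e ]≔ false))
        iT = indicator with-e
        iF = indicator without-e
        regroup : ∀ q t f s x → q * (t * (s * x) + f * s) ≈ s * (f * (1# * q) + t * (x * q))
        regroup = solve 5 (λ q t f s x → q :* (t :* (s :* x) :+ f :* s)
                                     := s :* (f :* (con 1 :* q) :+ t :* (x :* q))) ≈-refl

lemma1 : {c ℓ : Level} (R : CommutativeRing c ℓ) →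
    let open CommutativeRing R in
    (G : Multigraph) → ConnectedGraph G →
    (w : Fin (nE G) → Carrier) (e : Fin (nE G)) (j : ℕ) →
    (ws inv : Fin (suc j) → Carrier) → (∀ i → ws i * inv i ≈ 1#) →
    (w′ : Carrier) → w′ * sumFin R inv ≈ 1# →
    ZR R (φ G e j) (φw G e j w ws) ≈ (sumFin R inv * prodFin R ws) * ZR R G (update R w e w′)
lemma1 R G _ w e j ws inv ws*inv≈1 w′ w′*Σinv≈1 = begin
  ΣSub (nE G ℕ.+ j) (ZR-term H wφ)
    ≈⟨ ΣSub-++ (nE G) j (ZR-term H wφ) (ZR-term-congruent H wφ) ⟩
  ΣSub (nE G) ψ
    ≈⟨ ΣSub-pairUp (nE G) e ψ (λ B≗B′ → ΣSub-cong j λ C → ZR-term-congruent H wφ (++-congʳ C B≗B′)) ⟩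
  ΣSub (nE G) (pairUp e ψ)
    ≈⟨ ΣSub-cong (nE G) (pairUp-subdivided G w e j ws inv ws*inv≈1 w′ w′*Σinv≈1) ⟩
  ΣSub (nE G) (λ B → (sumFin R inv * prodFin R ws) * pairUp e (ZR-term G w″) B)
    ≈⟨ ≈-sym (sumList-map-*ˡ _ (pairUp e (ZR-term G w″)) (subsets (nE G))) ⟩
  (sumFin R inv * prodFin R ws) * ΣSub (nE G) (pairUp e (ZR-term G w″))
    ≈⟨ *-congˡ (≈-sym (ΣSub-pairUp (nE G) e (ZR-term G w″) (ZR-term-congruent G w″))) ⟩
  (sumFin R inv * prodFin R ws) * ZR R G w″ ∎
  where
  open CommutativeRing R hiding (zero) renaming (sym to ≈-sym)
  open import Relation.Binary.Reasoning.Setoid (CommutativeRing.setoid R)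
  open RingSums R
  open Reliability R
  open Subdivision G e j using (H)
  wφ  = φw G e j w ws
  w″  = update R w e w′
  ψ : EdgeSet G → Carrier
  ψ B = ΣSub j (λ C → ZR-term H wφ (B ++ C))
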